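{- Let $G$ be a connected, non-complete finite simple graph such that $G=H^2$ for some graph $H$ with girth at least seven, and let $F$ be the subgraph of $G$ consisting of all forced edges of $G$ (together with their endpoints). Then (i) $F$ is obtained from $H$ by deleting all end-vertices of $H$; (ii) for every maximal clique $Q$ in $G$, the induced subgraph $F[Q\cap V_F]$ is a star; and (iii) every vertex in $V_G\setminus V_F$ belongs to exactly one maximal clique in $G$.
   Context: All graphs are finite, undirected and simple. For a graph $H$, $H^2$ is the graph on the same vertex set in which two distinct vertices are adjacent iff their distance in $H$ is at most $2$. The girth of a graph is the length of a shortest cycle ($\infty$ if acyclic). A maximal clique is a set of pairwise adjacent vertices not properly contained in another such set. An edge of $G$ is called forced if it is contained in at least two distinct maximal cliques of $G$; $V_F$ denotes the vertex set of $F$ (the endpoints of forced edges). An end-vertex of $H$ is a vertex of degree one in $H$. A star is a graph with at least two vertices that has a vertex adjacent to all other vertices (a center vertex), the other vertices being pairwise non-adjacent. $F[X]$ denotes the subgraph of $F$ induced by $X$. -}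

module Defs where

open import Data.Nat using (ℕ; suc; _≤_)
open import Data.Bool using (Bool; true; false)
open import Data.Fin using (Fin; zero; suc; inject₁; fromℕ)
open import Data.Fin.Subset using (Subset; _∈_; _∉_; _⊆_; ∣_∣)
open import Data.Vec using (tabulate)
open import Data.Product using (Σ; ∃; ∃-syntax; _×_; _,_)
open import Data.Sum using (_⊎_)
open import Function.Definitions using (Injective)
open import Relation.Nullary using (¬_)
open import Relation.Binary.PropositionalEquality using (_≡_; _≢_)
open import Relation.Binary.Construct.Closure.ReflexiveTransitive using (Star)

record Graph (n : ℕ) : Set where
  field
    adj    : Fin n → Fin n → Bool
    sym    : ∀ u v → adj u v ≡ adj v u
    irrefl : ∀ v → adj v v ≡ false

module _ {n : ℕ} (G : Graph n) where
  open Graph G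

  Adj : Fin n → Fin n → Set
  Adj u v = adj u v ≡ true

  Nbhd : Fin n → Subset n
  Nbhd v = tabulate (adj v)

  degree : Fin n → ℕ
  degree v = ∣ Nbhd v ∣

  IsEndVertex : Fin n → Set
  IsEndVertex v = degree v ≡ 1

  Connected : Set
  Connected = ∀ u v → Star Adj u v

  Complete : Set
  Complete = ∀ u v → u ≢ v → Adj u v

  -- a cycle of length (suc m) ≥ 3: injective closed walk c₀ c₁ … c_m c₀
  IsCycle : (m : ℕ) → (Fin (suc m) → Fin n) → Set
  IsCycle m c = (3 ≤ suc m) × Injective _≡_ _≡_ c
              × (∀ (i : Fin m) → Adj (c (inject₁ i)) (c (suc i)))
              × Adj (c (fromℕ m)) (c zero)

  GirthAtLeast : ℕ → Set
  GirthAtLeast k = ∀ m c → IsCycle m c → k ≤ suc m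

  IsClique : Subset n → Set
  IsClique Q = ∀ u v → u ∈ Q → v ∈ Q → u ≢ v → Adj u v

  IsMaximalClique : Subset n → Set
  IsMaximalClique Q = IsClique Q × (∀ Q′ → IsClique Q′ → Q ⊆ Q′ → Q′ ⊆ Q)

  Forced : Fin n → Fin n → Set
  Forced u v = Adj u v ×
    ∃[ Q₁ ] ∃[ Q₂ ] (IsMaximalClique Q₁ × IsMaximalClique Q₂ × Q₁ ≢ Q₂
                     × u ∈ Q₁ × v ∈ Q₁ × u ∈ Q₂ × v ∈ Q₂)

  InVF : Fin n → Set
  InVF v = ∃[ u ] Forced v u

module _ {n : ℕ} (H : Graph n) where
  SqAdj : Fin n → Fin n → Set
  SqAdj u v = u ≢ v × (Adj H u v ⊎ ∃[ w ] (Adj H u w × Adj H w v))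

IsSquareOf : {n : ℕ} → Graph n → Graph n → Set
IsSquareOf G H = ∀ u v → (Adj G u v → SqAdj H u v) × (SqAdj H u v → Adj G u v)

IsStar : {n : ℕ} → (Fin n → Set) → (Fin n → Fin n → Set) → Set
IsStar X E =
  (∃[ x ] ∃[ y ] (X x × X y × x ≢ y)) ×
  ∃[ c ] (X c × (∀ x → X x → x ≢ c → E c x)
              × (∀ x y → X x → X y → x ≢ c → y ≢ c → ¬ E x y))

-- Since H has no cycles of length at most six, every clique of G = H² lies in a closed
-- neighbourhood N[w] of H, and N[w] is a maximal clique as soon as w has two neighbours;
-- for an end-vertex w with neighbour x, N[w] ⊆ N[x]. So the maximal cliques of G are
-- exactly the N[w] with w not an end-vertex. Two distinct such neighbourhoods share at
-- most an edge uv of H, and they share it precisely when neither u nor v is an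
-- end-vertex; (i)–(iii) follow. Connectivity and non-completeness of G serve only to
-- give every vertex a neighbour that is not an end-vertex.
module Submission where

open import Defs
open import Data.Nat using (ℕ; zero; suc; _+_; _≤_; _<_; s≤s; z≤n) renaming (_≟_ to _≟ℕ_)
open import Data.Nat.Properties using (<⇒≱; +-monoʳ-≤; n≮0; n<1⇒n≡0)
open import Data.Bool using (true) renaming (_≟_ to _≟ᵇ_)
open import Data.Fin using (Fin; zero; suc; inject₁; fromℕ; _≟_)
open import Data.Fin.Properties using (any?)
open import Data.Fin.Subset using (Subset; _∈_; _⊆_; _∪_; ⁅_⁆; _-_; ∣_∣)
open import Data.Fin.Subset.Properties
  using (⊆-antisym; _∈?_; x∈⁅x⁆; x∈⁅y⁆⇒x≡y; ∣⁅x⁆∣≡1; x∈p∪q⁺; x∈p∪q⁻; x∈p∧x≢y⇒x∈p-y; x∈p⇒∣p-x∣<∣p∣)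
open import Data.Vec using (Vec; []; _∷_; lookup)
open import Data.Vec.Properties using (lookup∘tabulate; lookup⇒[]=; []=⇒lookup)
open import Data.Vec.Relation.Unary.All using ([]; _∷_)
open import Data.Vec.Relation.Unary.AllPairs using ([]; _∷_)
open import Data.Vec.Relation.Unary.Linked using (Linked; []; [-]; _∷_)
open import Data.Vec.Relation.Unary.Unique.Propositional using (Unique)
open import Data.Vec.Relation.Unary.Unique.Propositional.Properties using (lookup-injective)
open import Data.Product using (∃-syntax; _×_; _,_; proj₁; proj₂)
open import Data.Sum using (_⊎_; inj₁; inj₂)
open import Data.Empty using (⊥; ⊥-elim)
open import Relation.Binary.Core using (Rel)
open import Relation.Nullary using (¬_; Dec; yes; no)
open import Relation.Nullary.Decidable using (_×-dec_; _⊎-dec_; ¬?; decidable-stable)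
open import Relation.Binary.Construct.Closure.ReflexiveTransitive using (Star; ε; _◅_)
open import Relation.Binary.PropositionalEquality using (_≡_; _≢_; refl; sym; trans; subst; cong)

linked-lookup : ∀ {a ℓ} {A : Set a} {R : Rel A ℓ} {m} {xs : Vec A (suc m)} →
                Linked R xs → (i : Fin m) → R (lookup xs (inject₁ i)) (lookup xs (suc i))
linked-lookup {xs = _ ∷ _ ∷ _} (r ∷ _) zero = r
linked-lookup {xs = _ ∷ _ ∷ _} (_ ∷ rs) (suc i) = linked-lookup rs i

module Adjacency {n : ℕ} (H : Graph n) where

  adj-sym : ∀ {u v} → Adj H u v → Adj H v u
  adj-sym {u} {v} uv = trans (Graph.sym H v u) uv

  adj⇒≢ : ∀ {u v} → Adj H u v → u ≢ v
  adj⇒≢ {u} uv refl with trans (sym uv) (Graph.irrefl H u)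
  ... | ()

  adj? : ∀ u v → Dec (Adj H u v)
  adj? u v = Graph.adj H u v ≟ᵇ true

  adj⇒∈Nbhd : ∀ {v x} → Adj H v x → x ∈ Nbhd H v
  adj⇒∈Nbhd {v} {x} vx = lookup⇒[]= x _ (trans (lookup∘tabulate (Graph.adj H v) x) vx)

  ∈Nbhd⇒adj : ∀ {v x} → x ∈ Nbhd H v → Adj H v x
  ∈Nbhd⇒adj {v} {x} x∈ = trans (sym (lookup∘tabulate (Graph.adj H v) x)) ([]=⇒lookup x∈)

  end-vertex-nbr-unique : ∀ {v a b} → IsEndVertex H v → Adj H v a → Adj H v b → a ≡ b
  end-vertex-nbr-unique {v} {a} {b} end va vb with a ≟ b
  ... | yes a≡b = a≡b
  ... | no a≢b = ⊥-elim (n≮0 (subst (∣ Nbhd H v - b - a ∣ <_) ∣N-b∣≡0 (x∈p⇒∣p-x∣<∣p∣ a∈N-b)))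
    where
    a∈N-b : a ∈ Nbhd H v - b
    a∈N-b = x∈p∧x≢y⇒x∈p-y (adj⇒∈Nbhd va) a≢b
    ∣N-b∣≡0 : ∣ Nbhd H v - b ∣ ≡ 0
    ∣N-b∣≡0 = n<1⇒n≡0 (subst (∣ Nbhd H v - b ∣ <_) end (x∈p⇒∣p-x∣<∣p∣ (adj⇒∈Nbhd vb)))

  non-end⇒another-nbr : ∀ {v a} → ¬ IsEndVertex H v → Adj H v a → ∃[ b ] (Adj H v b × b ≢ a)
  non-end⇒another-nbr {v} {a} ¬end va with any? (λ b → adj? v b ×-dec ¬? (b ≟ a))
  ... | yes found = found
  ... | no none = ⊥-elim (¬end (subst (λ p → ∣ p ∣ ≡ 1) (sym Nbhd≡⁅a⁆) (∣⁅x⁆∣≡1 a)))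
    where
    only-a : ∀ {b} → b ∈ Nbhd H v → b ∈ ⁅ a ⁆
    only-a {b} b∈ with b ≟ a
    ... | yes refl = x∈⁅x⁆ a
    ... | no b≢a = ⊥-elim (none (b , ∈Nbhd⇒adj b∈ , b≢a))
    Nbhd≡⁅a⁆ : Nbhd H v ≡ ⁅ a ⁆
    Nbhd≡⁅a⁆ = ⊆-antisym only-a (λ b∈⁅a⁆ → subst (_∈ Nbhd H v) (sym (x∈⁅y⁆⇒x≡y a b∈⁅a⁆)) (adj⇒∈Nbhd va))

  infix 4 _∈N[_]
  _∈N[_] : Fin n → Fin n → Set
  x ∈N[ w ] = x ≡ w ⊎ Adj H w x

  N[_] : Fin n → Subset n
  N[ w ] = ⁅ w ⁆ ∪ Nbhd H w

  ∈N[]⁺ : ∀ {w x} → x ∈N[ w ] → x ∈ N[ w ]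
  ∈N[]⁺ {w} (inj₁ refl) = x∈p∪q⁺ (inj₁ (x∈⁅x⁆ w))
  ∈N[]⁺     (inj₂ wx)   = x∈p∪q⁺ (inj₂ (adj⇒∈Nbhd wx))

  ∈N[]⁻ : ∀ {w x} → x ∈ N[ w ] → x ∈N[ w ]
  ∈N[]⁻ {w} x∈ with x∈p∪q⁻ ⁅ w ⁆ (Nbhd H w) x∈
  ... | inj₁ x∈⁅w⁆ = inj₁ (x∈⁅y⁆⇒x≡y w x∈⁅w⁆)
  ... | inj₂ x∈Nw  = inj₂ (∈Nbhd⇒adj x∈Nw)

  _∈N[_]? : ∀ x w → Dec (x ∈N[ w ])
  x ∈N[ w ]? = (x ≟ w) ⊎-dec adj? w x

  ≢∧¬adj⇒∉N[] : ∀ {x y} → x ≢ y → ¬ Adj H y x → ¬ x ∈N[ y ]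
  ≢∧¬adj⇒∉N[] x≢y _    (inj₁ x≡y) = x≢y x≡y
  ≢∧¬adj⇒∉N[] _   ¬yx (inj₂ yx)  = ¬yx yx

  nonadjacent∈N[]⇒nbrs : ∀ {u v w} → u ≢ v → ¬ Adj H u v → u ∈N[ w ] → v ∈N[ w ] → Adj H w u × Adj H w v
  nonadjacent∈N[]⇒nbrs u≢v ¬uv (inj₁ refl) (inj₁ refl) = ⊥-elim (u≢v refl)
  nonadjacent∈N[]⇒nbrs u≢v ¬uv (inj₁ refl) (inj₂ uv)   = ⊥-elim (¬uv uv)
  nonadjacent∈N[]⇒nbrs u≢v ¬uv (inj₂ vu)   (inj₁ refl) = ⊥-elim (¬uv (adj-sym vu))
  nonadjacent∈N[]⇒nbrs u≢v ¬uv (inj₂ wu)   (inj₂ wv)   = wu , wv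

  Dist≤2 : Fin n → Fin n → Set
  Dist≤2 x y = x ≡ y ⊎ SqAdj H x y

  dist≤2⇒path₂ : ∀ {x y} → Dist≤2 x y → ¬ x ∈N[ y ] → ∃[ s ] (Adj H x s × Adj H s y)
  dist≤2⇒path₂ (inj₁ x≡y)          x∉ = ⊥-elim (x∉ (inj₁ x≡y))
  dist≤2⇒path₂ (inj₂ (_ , inj₁ xy)) x∉ = ⊥-elim (x∉ (inj₂ (adj-sym xy)))
  dist≤2⇒path₂ (inj₂ (_ , inj₂ p))  _  = p

  end⇒N[]⊆N[nbr] : ∀ {v u x} → IsEndVertex H v → Adj H v u → x ∈N[ v ] → x ∈N[ u ]
  end⇒N[]⊆N[nbr] end vu (inj₁ refl) = inj₂ (adj-sym vu)
  end⇒N[]⊆N[nbr] end vu (inj₂ vx)   = inj₁ (end-vertex-nbr-unique end vx vu)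

module ShortCycles {n : ℕ} (H : Graph n) (girth : GirthAtLeast H 7) where
  open Adjacency H

  no-short-cycle : ∀ {m} → m ≤ 3 → (vs : Vec (Fin n) (3 + m)) → Unique vs → Linked (Adj H) vs →
                   Adj H (lookup vs (fromℕ (2 + m))) (lookup vs zero) → ⊥
  no-short-cycle m≤3 vs distinct path closing =
    <⇒≱ (s≤s (+-monoʳ-≤ 3 m≤3))
        (girth _ (lookup vs) (s≤s (s≤s (s≤s z≤n)) , (λ {i} {j} → lookup-injective distinct i j) ,
                              linked-lookup path , closing))

  no-triangle : ∀ {v₀ v₁ v₂} → Adj H v₀ v₁ → Adj H v₁ v₂ → Adj H v₂ v₀ → ⊥
  no-triangle a₀ a₁ a₂ = no-short-cycle z≤n (_ ∷ _ ∷ _ ∷ [])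
    ((adj⇒≢ a₀ ∷ adj⇒≢ (adj-sym a₂) ∷ []) ∷ (adj⇒≢ a₁ ∷ []) ∷ [] ∷ [])
    (a₀ ∷ a₁ ∷ [-]) a₂

  no-4-cycle : ∀ {v₀ v₁ v₂ v₃} → Adj H v₀ v₁ → Adj H v₁ v₂ → Adj H v₂ v₃ → Adj H v₃ v₀ →
               v₀ ≢ v₂ → v₁ ≢ v₃ → ⊥
  no-4-cycle a₀ a₁ a₂ a₃ d₀₂ d₁₃ = no-short-cycle (s≤s z≤n) (_ ∷ _ ∷ _ ∷ _ ∷ [])
    ((adj⇒≢ a₀ ∷ d₀₂ ∷ adj⇒≢ (adj-sym a₃) ∷ []) ∷ (adj⇒≢ a₁ ∷ d₁₃ ∷ []) ∷ (adj⇒≢ a₂ ∷ []) ∷ [] ∷ [])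
    (a₀ ∷ a₁ ∷ a₂ ∷ [-]) a₃

  -- Closed walks v₀ … vₖ₋₁ v₀ that never backtrack (vᵢ ≢ vᵢ₊₂); the remaining
  -- non-backtracking condition v₁ ≢ vₖ₋₁ follows from the absence of shorter cycles.
  no-closed-walk₅ : ∀ {v₀ v₁ v₂ v₃ v₄} →
    Adj H v₀ v₁ → Adj H v₁ v₂ → Adj H v₂ v₃ → Adj H v₃ v₄ → Adj H v₄ v₀ →
    v₀ ≢ v₂ → v₁ ≢ v₃ → v₂ ≢ v₄ → v₃ ≢ v₀ → ⊥
  no-closed-walk₅ {v₁ = v₁} {v₄ = v₄} a₀ a₁ a₂ a₃ a₄ d₀₂ d₁₃ d₂₄ d₃₀ with v₁ ≟ v₄
  ... | yes refl = no-triangle a₁ a₂ a₃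
  ... | no d₁₄ = no-short-cycle (s≤s (s≤s z≤n)) (_ ∷ _ ∷ _ ∷ _ ∷ _ ∷ [])
    ((adj⇒≢ a₀ ∷ d₀₂ ∷ (λ e → d₃₀ (sym e)) ∷ adj⇒≢ (adj-sym a₄) ∷ []) ∷
     (adj⇒≢ a₁ ∷ d₁₃ ∷ d₁₄ ∷ []) ∷ (adj⇒≢ a₂ ∷ d₂₄ ∷ []) ∷ (adj⇒≢ a₃ ∷ []) ∷ [] ∷ [])
    (a₀ ∷ a₁ ∷ a₂ ∷ a₃ ∷ [-]) a₄

  no-closed-walk₆ : ∀ {v₀ v₁ v₂ v₃ v₄ v₅} →
    Adj H v₀ v₁ → Adj H v₁ v₂ → Adj H v₂ v₃ → Adj H v₃ v₄ → Adj H v₄ v₅ → Adj H v₅ v₀ →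
    v₀ ≢ v₂ → v₁ ≢ v₃ → v₂ ≢ v₄ → v₃ ≢ v₅ → v₄ ≢ v₀ → ⊥
  no-closed-walk₆ {v₀} {v₁} {v₂} {v₃} {v₄} {v₅} a₀ a₁ a₂ a₃ a₄ a₅ d₀₂ d₁₃ d₂₄ d₃₅ d₄₀
    with v₀ ≟ v₃ | v₁ ≟ v₄ | v₂ ≟ v₅ | v₁ ≟ v₅
  ... | yes refl | _ | _ | _ = no-triangle a₀ a₁ a₂
  ... | no _ | yes refl | _ | _ = no-triangle a₁ a₂ a₃
  ... | no _ | no _ | yes refl | _ = no-triangle a₂ a₃ a₄
  ... | no _ | no _ | no _ | yes refl = no-4-cycle a₁ a₂ a₃ a₄ d₁₃ d₂₄
  ... | no d₀₃ | no d₁₄ | no d₂₅ | no d₁₅ = no-short-cycle (s≤s (s≤s (s≤s z≤n))) (_ ∷ _ ∷ _ ∷ _ ∷ _ ∷ _ ∷ [])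
    ((adj⇒≢ a₀ ∷ d₀₂ ∷ d₀₃ ∷ (λ e → d₄₀ (sym e)) ∷ adj⇒≢ (adj-sym a₅) ∷ []) ∷
     (adj⇒≢ a₁ ∷ d₁₃ ∷ d₁₄ ∷ d₁₅ ∷ []) ∷ (adj⇒≢ a₂ ∷ d₂₄ ∷ d₂₅ ∷ []) ∷
     (adj⇒≢ a₃ ∷ d₃₅ ∷ []) ∷ (adj⇒≢ a₄ ∷ []) ∷ [] ∷ [])
    (a₀ ∷ a₁ ∷ a₂ ∷ a₃ ∷ a₄ ∷ [-]) a₅

  common-nbr-unique : ∀ {u v w w′} → Adj H w u → Adj H w v → Adj H w′ u → Adj H w′ v → u ≢ v → w ≡ w′
  common-nbr-unique {w = w} {w′} wu wv w′u w′v u≢v with w ≟ w′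
  ... | yes w≡w′ = w≡w′
  ... | no w≢w′ = ⊥-elim (no-4-cycle (adj-sym wu) wv (adj-sym w′v) w′u u≢v w≢w′)

  near-edge⇒near-endpoint : ∀ {a b y} → Adj H a b → Dist≤2 y a → Dist≤2 y b → y ∈N[ a ] ⊎ y ∈N[ b ]
  near-edge⇒near-endpoint {a} {b} {y} ab ya yb with y ∈N[ a ]? | y ∈N[ b ]?
  ... | yes y∈Na | _        = inj₁ y∈Na
  ... | no _     | yes y∈Nb = inj₂ y∈Nb
  ... | no y∉Na  | no y∉Nb with dist≤2⇒path₂ ya y∉Na | dist≤2⇒path₂ yb y∉Nb
  ...   | s , ys , sa | t , yt , tb with t ≟ s
  ...     | yes refl = ⊥-elim (no-triangle ab (adj-sym tb) sa)
  ...     | no t≢s = ⊥-elim (no-closed-walk₅ ab (adj-sym tb) (adj-sym yt) ys sa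
                       (λ { refl → y∉Na (inj₂ (adj-sym yt)) }) (λ { refl → y∉Nb (inj₁ refl) })
                       t≢s (λ y≡a → y∉Na (inj₁ y≡a)))

  far-from-other-branch : ∀ {w s z x} → Adj H w s → Adj H s z → Adj H w x → x ≢ s → ¬ z ∈N[ w ] →
                          ¬ Dist≤2 z x
  far-from-other-branch ws sz wx x≢s z∉Nw (inj₁ refl) = z∉Nw (inj₂ wx)
  far-from-other-branch ws sz wx x≢s z∉Nw (inj₂ (_ , inj₁ zx)) =
    no-4-cycle ws sz zx (adj-sym wx) (λ { refl → z∉Nw (inj₁ refl) }) (λ { refl → x≢s refl })
  far-from-other-branch {s = s} ws sz wx x≢s z∉Nw (inj₂ (_ , inj₂ (r , zr , rx))) with s ≟ r
  ... | yes refl = no-triangle ws rx (adj-sym wx)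
  ... | no s≢r = no-closed-walk₅ ws sz zr rx (adj-sym wx) (λ { refl → z∉Nw (inj₁ refl) }) s≢r
                   (λ { refl → z∉Nw (inj₂ wx) }) (λ { refl → z∉Nw (inj₂ (adj-sym zr)) })

module Square {n : ℕ} (G H : Graph n) (sq : IsSquareOf G H) (girth : GirthAtLeast H 7) where
  open Adjacency H
  open ShortCycles H girth

  clique⇒dist≤2 : ∀ {Q x y} → IsClique G Q → x ∈ Q → y ∈ Q → Dist≤2 x y
  clique⇒dist≤2 {x = x} {y} cl x∈Q y∈Q with x ≟ y
  ... | yes x≡y = inj₁ x≡y
  ... | no x≢y = inj₂ (proj₁ (sq x y) (cl x y x∈Q y∈Q x≢y))

  N[]-clique : ∀ w → IsClique G N[ w ]
  N[]-clique w x y x∈ y∈ x≢y = proj₂ (sq x y) (x≢y , path (∈N[]⁻ x∈) (∈N[]⁻ y∈))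
    where
    path : x ∈N[ w ] → y ∈N[ w ] → Adj H x y ⊎ ∃[ v ] (Adj H x v × Adj H v y)
    path (inj₁ refl) (inj₁ refl) = ⊥-elim (x≢y refl)
    path (inj₁ refl) (inj₂ wy)   = inj₁ wy
    path (inj₂ wx)   (inj₁ refl) = inj₁ (adj-sym wx)
    path (inj₂ wx)   (inj₂ wy)   = inj₂ (w , adj-sym wx , wy)

  edge-clique⊆N[] : ∀ {Q a b} → IsClique G Q → a ∈ Q → b ∈ Q → Adj H a b → ∃[ w ] (Q ⊆ N[ w ])
  edge-clique⊆N[] {Q} {a} {b} cl a∈Q b∈Q ab with any? (λ z → z ∈? Q ×-dec ¬? (z ∈N[ a ]?))
  ... | no none = a , λ {y} y∈Q → ∈N[]⁺ (decidable-stable (y ∈N[ a ]?) (λ y∉ → none (y , y∈Q , y∉)))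
  ... | yes (z , z∈Q , z∉Na) = b , λ {y} y∈Q → ∈N[]⁺ (in-Nb y∈Q)
    where
    near : ∀ {y} → y ∈ Q → y ∈N[ a ] ⊎ y ∈N[ b ]
    near y∈Q = near-edge⇒near-endpoint ab (clique⇒dist≤2 cl y∈Q a∈Q) (clique⇒dist≤2 cl y∈Q b∈Q)
    bz : Adj H b z
    bz with near z∈Q
    ... | inj₁ z∈Na        = ⊥-elim (z∉Na z∈Na)
    ... | inj₂ (inj₁ refl) = ⊥-elim (z∉Na (inj₂ ab))
    ... | inj₂ (inj₂ bz)   = bz
    in-Nb : ∀ {y} → y ∈ Q → y ∈N[ b ]
    in-Nb {y} y∈Q with y ∈N[ b ]? | near y∈Q
    ... | yes y∈Nb | _ = y∈Nb
    ... | no y∉Nb | inj₂ y∈Nb        = ⊥-elim (y∉Nb y∈Nb)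
    ... | no y∉Nb | inj₁ (inj₁ refl) = ⊥-elim (y∉Nb (inj₂ (adj-sym ab)))
    ... | no y∉Nb | inj₁ (inj₂ ay)   =
      ⊥-elim (far-from-other-branch ab bz ay (λ { refl → y∉Nb (inj₁ refl) }) z∉Na (clique⇒dist≤2 cl z∈Q y∈Q))

  independent-clique⊆N[] : ∀ {Q a b} → IsClique G Q → (∀ {x y} → x ∈ Q → y ∈ Q → ¬ Adj H x y) →
                           a ∈ Q → b ∈ Q → a ≢ b → ∃[ w ] (Q ⊆ N[ w ])
  independent-clique⊆N[] {Q} {a} {b} cl indep a∈Q b∈Q a≢b
    with dist≤2⇒path₂ (clique⇒dist≤2 cl a∈Q b∈Q) (≢∧¬adj⇒∉N[] a≢b (indep b∈Q a∈Q))
  ... | t , at , tb = t , λ {y} y∈Q → ∈N[]⁺ (decidable-stable (y ∈N[ t ]?) (outside y∈Q))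
    where
    outside : ∀ {y} → y ∈ Q → ¬ ¬ y ∈N[ t ]
    outside {y} y∈Q y∉Nt
      with dist≤2⇒path₂ (clique⇒dist≤2 cl y∈Q a∈Q) (≢∧¬adj⇒∉N[] (λ { refl → y∉Nt (inj₂ (adj-sym at)) }) (indep a∈Q y∈Q))
         | dist≤2⇒path₂ (clique⇒dist≤2 cl y∈Q b∈Q) (≢∧¬adj⇒∉N[] (λ { refl → y∉Nt (inj₂ tb) }) (indep b∈Q y∈Q))
    ... | s , ys , sa | r , yr , rb with r ≟ s
    ...   | yes refl = no-4-cycle at tb (adj-sym rb) sa a≢b (λ { refl → y∉Nt (inj₂ (adj-sym ys)) })
    ...   | no r≢s = no-closed-walk₆ at tb (adj-sym rb) (adj-sym yr) ys sa a≢b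
                       (λ { refl → y∉Nt (inj₂ (adj-sym yr)) }) (λ { refl → y∉Nt (inj₂ tb) }) r≢s
                       (λ { refl → y∉Nt (inj₂ (adj-sym at)) })

  clique⊆N[] : ∀ {Q a} → IsClique G Q → a ∈ Q → ∃[ w ] (Q ⊆ N[ w ])
  clique⊆N[] {Q} {a} cl a∈Q with any? (λ x → any? (λ y → x ∈? Q ×-dec y ∈? Q ×-dec adj? x y))
  ... | yes (x , y , x∈Q , y∈Q , xy) = edge-clique⊆N[] cl x∈Q y∈Q xy
  ... | no no-edge with any? (λ b → b ∈? Q ×-dec ¬? (b ≟ a))
  ...   | yes (b , b∈Q , b≢a) =
    independent-clique⊆N[] cl (λ x∈Q y∈Q xy → no-edge (_ , _ , x∈Q , y∈Q , xy)) b∈Q a∈Q b≢a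
  ...   | no only-a =
    a , λ {y} y∈Q → ∈N[]⁺ (inj₁ (decidable-stable (y ≟ a) (λ y≢a → only-a (y , y∈Q , y≢a))))

  maximal-clique-nonempty : ∀ {Q} → Fin n → IsMaximalClique G Q → ∃[ a ] a ∈ Q
  maximal-clique-nonempty {Q} v (_ , maximal) with any? (_∈? Q)
  ... | yes nonempty = nonempty
  ... | no empty = ⊥-elim (empty (v , maximal ⁅ v ⁆ singleton-clique (λ {x} x∈Q → ⊥-elim (empty (x , x∈Q))) (x∈⁅x⁆ v)))
    where
    singleton-clique : IsClique G ⁅ v ⁆
    singleton-clique x y x∈ y∈ x≢y = ⊥-elim (x≢y (trans (x∈⁅y⁆⇒x≡y v x∈) (sym (x∈⁅y⁆⇒x≡y v y∈))))

  maximal-clique⊆N[]⇒≡ : ∀ {Q w} → IsMaximalClique G Q → Q ⊆ N[ w ] → Q ≡ N[ w ]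
  maximal-clique⊆N[]⇒≡ {w = w} (_ , maximal) Q⊆Nw = ⊆-antisym Q⊆Nw (maximal N[ w ] (N[]-clique w) Q⊆Nw)

  maximal-clique≡N[] : ∀ {Q} → Fin n → IsMaximalClique G Q → ∃[ w ] (Q ≡ N[ w ])
  maximal-clique≡N[] v Qmax with maximal-clique-nonempty v Qmax
  ... | a , a∈Q with clique⊆N[] (proj₁ Qmax) a∈Q
  ...   | w , Q⊆Nw = w , maximal-clique⊆N[]⇒≡ Qmax Q⊆Nw

  N[]-maximal : ∀ {w p q} → Adj H w p → Adj H w q → p ≢ q → IsMaximalClique G N[ w ]
  N[]-maximal {w} {p} {q} wp wq p≢q = N[]-clique w , grow
    where
    grow : ∀ Q′ → IsClique G Q′ → N[ w ] ⊆ Q′ → Q′ ⊆ N[ w ]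
    grow Q′ cl′ Nw⊆Q′ {z} z∈Q′ = ∈N[]⁺ (decidable-stable (z ∈N[ w ]?) outside)
      where
      in-Q′ : ∀ {x} → Adj H w x → x ∈ Q′
      in-Q′ wx = Nw⊆Q′ (∈N[]⁺ (inj₂ wx))
      outside : ¬ ¬ z ∈N[ w ]
      outside z∉Nw with dist≤2⇒path₂ (clique⇒dist≤2 cl′ z∈Q′ (Nw⊆Q′ (∈N[]⁺ (inj₁ refl)))) z∉Nw
      ... | s , zs , sw with p ≟ s
      ...   | yes refl = far-from-other-branch (adj-sym sw) (adj-sym zs) wq (λ { refl → p≢q refl }) z∉Nw
                           (clique⇒dist≤2 cl′ z∈Q′ (in-Q′ wq))
      ...   | no p≢s = far-from-other-branch (adj-sym sw) (adj-sym zs) wp p≢s z∉Nw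
                         (clique⇒dist≤2 cl′ z∈Q′ (in-Q′ wp))

¬complete⇒vertex : ∀ {n} (G : Graph n) → ¬ Complete G → Fin n
¬complete⇒vertex {zero}  G ¬complete = ⊥-elim (¬complete (λ ()))
¬complete⇒vertex {suc _} G _         = zero

module Structure {n : ℕ} (G H : Graph n) (sq : IsSquareOf G H) (girth : GirthAtLeast H 7)
                 (connected : Connected G) (¬complete : ¬ Complete G) where
  open Adjacency H
  open ShortCycles H girth
  open Square G H sq girth

  End : Fin n → Set
  End = IsEndVertex H

  end? : ∀ v → Dec (End v)
  end? v = degree H v ≟ℕ 1


  all-nbrs-end⇒N[]-closed : ∀ {w x y} → (∀ {u} → Adj H w u → End u) → x ∈N[ w ] → Adj G x y → y ∈N[ w ]
  all-nbrs-end⇒N[]-closed ends x∈Nw xy with x∈Nw | proj₂ (proj₁ (sq _ _) xy)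
  ... | inj₁ refl | inj₁ wy              = inj₂ wy
  ... | inj₁ refl | inj₂ (t , wt , ty)   = inj₁ (end-vertex-nbr-unique (ends wt) ty (adj-sym wt))
  ... | inj₂ wx   | inj₁ xy′             = inj₁ (end-vertex-nbr-unique (ends wx) xy′ (adj-sym wx))
  ... | inj₂ wx   | inj₂ (t , xt , ty)   = inj₂ (subst (λ s → Adj H s _) (end-vertex-nbr-unique (ends wx) xt (adj-sym wx)) ty)

  non-end-nbr : ∀ w → ∃[ x ] (Adj H w x × ¬ End x)
  non-end-nbr w with any? (λ x → adj? w x ×-dec ¬? (end? x))
  ... | yes found = found
  ... | no none = ⊥-elim (¬complete (λ x y x≢y → N[]-clique w x y (∈N[]⁺ (reach (inj₁ refl) (connected w x))) (∈N[]⁺ (reach (inj₁ refl) (connected w y))) x≢y))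
    where
    ends : ∀ {u} → Adj H w u → End u
    ends {u} wu = decidable-stable (end? u) (λ ¬end → none (u , wu , ¬end))
    reach : ∀ {x y} → x ∈N[ w ] → Star (Adj G) x y → y ∈N[ w ]
    reach x∈Nw ε          = x∈Nw
    reach x∈Nw (xz ◅ z⋆y) = reach (all-nbrs-end⇒N[]-closed ends x∈Nw xz) z⋆y

  vertex : Fin n
  vertex = ¬complete⇒vertex G ¬complete

  non-end⇒N[]-maximal : ∀ {w} → ¬ End w → IsMaximalClique G N[ w ]
  non-end⇒N[]-maximal {w} ¬end with non-end-nbr w
  ... | p , wp , _ with non-end⇒another-nbr ¬end wp
  ...   | q , wq , q≢p = N[]-maximal wp wq (λ p≡q → q≢p (sym p≡q))

  end-vertex-clique : ∀ {Q v x} → End v → Adj H v x → IsMaximalClique G Q → v ∈ Q → Q ≡ N[ x ]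
  end-vertex-clique {Q} {v} {x} end vx Qmax v∈Q with maximal-clique≡N[] vertex Qmax
  ... | w , refl = maximal-clique⊆N[]⇒≡ Qmax (λ y∈Nw → ∈N[]⁺ (Nw⊆Nx (∈N[]⁻ v∈Q) (∈N[]⁻ y∈Nw)))
    where
    Nw⊆Nx : ∀ {y} → v ∈N[ w ] → y ∈N[ w ] → y ∈N[ x ]
    Nw⊆Nx (inj₁ refl) = end⇒N[]⊆N[nbr] end vx
    Nw⊆Nx (inj₂ wv)   = subst (_ ∈N[_]) (end-vertex-nbr-unique end (adj-sym wv) vx)

  maximal-clique≡N[non-end] : ∀ {Q} → IsMaximalClique G Q → ∃[ c ] (¬ End c × Q ≡ N[ c ])
  maximal-clique≡N[non-end] Qmax with maximal-clique≡N[] vertex Qmax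
  ... | w , Q≡Nw with end? w
  ...   | no ¬end = w , ¬end , Q≡Nw
  ...   | yes end with non-end-nbr w
  ...     | c , wc , ¬end = c , ¬end , end-vertex-clique end wc Qmax (subst (w ∈_) (sym Q≡Nw) (∈N[]⁺ (inj₁ refl)))

  forced-sym : ∀ {u v} → Forced G u v → Forced G v u
  forced-sym (uv , Q₁ , Q₂ , Q₁max , Q₂max , Q₁≢Q₂ , u∈Q₁ , v∈Q₁ , u∈Q₂ , v∈Q₂) =
    trans (Graph.sym G _ _) uv , Q₁ , Q₂ , Q₁max , Q₂max , Q₁≢Q₂ , v∈Q₁ , u∈Q₁ , v∈Q₂ , u∈Q₂

  forced⇒adj : ∀ {u v} → Forced G u v → Adj H u v
  forced⇒adj {u} {v} (uv , _ , _ , Q₁max , Q₂max , Q₁≢Q₂ , u∈Q₁ , v∈Q₁ , u∈Q₂ , v∈Q₂) with adj? u v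
  ... | yes uv′ = uv′
  ... | no ¬uv with Adjacency.adj⇒≢ G uv | maximal-clique≡N[] vertex Q₁max | maximal-clique≡N[] vertex Q₂max
  ...   | u≢v | w₁ , refl | w₂ , refl
    with nonadjacent∈N[]⇒nbrs u≢v ¬uv (∈N[]⁻ u∈Q₁) (∈N[]⁻ v∈Q₁)
       | nonadjacent∈N[]⇒nbrs u≢v ¬uv (∈N[]⁻ u∈Q₂) (∈N[]⁻ v∈Q₂)
  ...     | w₁u , w₁v | w₂u , w₂v = ⊥-elim (Q₁≢Q₂ (cong N[_] (common-nbr-unique w₁u w₁v w₂u w₂v u≢v)))

  forced⇒non-end : ∀ {u v} → Forced G u v → ¬ End u
  forced⇒non-end f@(_ , _ , _ , Q₁max , Q₂max , Q₁≢Q₂ , u∈Q₁ , _ , u∈Q₂ , _) end =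
    Q₁≢Q₂ (trans (end-vertex-clique end (forced⇒adj f) Q₁max u∈Q₁)
                 (sym (end-vertex-clique end (forced⇒adj f) Q₂max u∈Q₂)))

  non-end-edge⇒forced : ∀ {u v} → Adj H u v → ¬ End u → ¬ End v → Forced G u v
  non-end-edge⇒forced {u} {v} uv ¬end-u ¬end-v =
    proj₂ (sq u v) (adj⇒≢ uv , inj₁ uv) , N[ u ] , N[ v ] ,
    non-end⇒N[]-maximal ¬end-u , non-end⇒N[]-maximal ¬end-v , Nu≢Nv ,
    ∈N[]⁺ (inj₁ refl) , ∈N[]⁺ (inj₂ uv) , ∈N[]⁺ (inj₂ (adj-sym uv)) , ∈N[]⁺ (inj₁ refl)
    where
    Nu≢Nv : N[ u ] ≢ N[ v ]
    Nu≢Nv Nu≡Nv with non-end⇒another-nbr ¬end-u uv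
    ... | p , up , p≢v with ∈N[]⁻ (subst (p ∈_) Nu≡Nv (∈N[]⁺ (inj₂ up)))
    ...   | inj₁ p≡v = p≢v p≡v
    ...   | inj₂ vp  = no-triangle uv vp (adj-sym up)

  VF⇒non-end : ∀ {v} → InVF G v → ¬ End v
  VF⇒non-end (_ , f) = forced⇒non-end f

  non-end⇒VF : ∀ {v} → ¬ End v → InVF G v
  non-end⇒VF {v} ¬end with non-end-nbr v
  ... | x , vx , ¬end-x = x , non-end-edge⇒forced vx ¬end ¬end-x

  maximal-clique∩VF-star : ∀ {Q} → IsMaximalClique G Q → IsStar (λ v → v ∈ Q × InVF G v) (Forced G)
  maximal-clique∩VF-star Qmax with maximal-clique≡N[non-end] Qmax
  ... | c , ¬end-c , refl with non-end-nbr c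
  ...   | x , cx , ¬end-x =
    (c , x , (c∈Nc , non-end⇒VF ¬end-c) , (∈N[]⁺ (inj₂ cx) , non-end⇒VF ¬end-x) , adj⇒≢ cx) ,
    c , (c∈Nc , non-end⇒VF ¬end-c) , centre , leaves
    where
    c∈Nc : c ∈ N[ c ]
    c∈Nc = ∈N[]⁺ (inj₁ refl)
    nbr : ∀ {y} → y ∈ N[ c ] → y ≢ c → Adj H c y
    nbr y∈Nc y≢c with ∈N[]⁻ y∈Nc
    ... | inj₁ y≡c = ⊥-elim (y≢c y≡c)
    ... | inj₂ cy  = cy
    centre : ∀ y → y ∈ N[ c ] × InVF G y → y ≢ c → Forced G c y
    centre y (y∈Nc , y∈VF) y≢c = non-end-edge⇒forced (nbr y∈Nc y≢c) ¬end-c (VF⇒non-end y∈VF)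
    leaves : ∀ y z → y ∈ N[ c ] × InVF G y → z ∈ N[ c ] × InVF G z → y ≢ c → z ≢ c → ¬ Forced G y z
    leaves y z (y∈Nc , _) (z∈Nc , _) y≢c z≢c yz = no-triangle (nbr y∈Nc y≢c) (forced⇒adj yz) (adj-sym (nbr z∈Nc z≢c))

  outside-VF⇒unique-maximal-clique : ∀ {v} → ¬ InVF G v →
    ∃[ Q ] (IsMaximalClique G Q × v ∈ Q × (∀ Q′ → IsMaximalClique G Q′ → v ∈ Q′ → Q′ ≡ Q))
  outside-VF⇒unique-maximal-clique {v} v∉VF with non-end-nbr v
  ... | x , vx , ¬end-x =
    N[ x ] , non-end⇒N[]-maximal ¬end-x , ∈N[]⁺ (inj₂ (adj-sym vx)) ,
    λ Q′ Q′max v∈Q′ → end-vertex-clique end vx Q′max v∈Q′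
    where
    end : End v
    end = decidable-stable (end? v) (λ ¬end → v∉VF (non-end⇒VF ¬end))

proposition2p3 : (n : ℕ) (G H : Graph n) →
    Connected G → ¬ Complete G → IsSquareOf G H → GirthAtLeast H 7 →
    ((∀ v → (InVF G v → ¬ IsEndVertex H v) × (¬ IsEndVertex H v → InVF G v))
     × (∀ u v → (Forced G u v → Adj H u v × ¬ IsEndVertex H u × ¬ IsEndVertex H v)
              × (Adj H u v × ¬ IsEndVertex H u × ¬ IsEndVertex H v → Forced G u v)))
    × (∀ Q → IsMaximalClique G Q → IsStar (λ v → v ∈ Q × InVF G v) (Forced G))
    × (∀ v → ¬ InVF G v →
         ∃[ Q ] (IsMaximalClique G Q × v ∈ Q
                 × (∀ Q′ → IsMaximalClique G Q′ → v ∈ Q′ → Q′ ≡ Q)))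
proposition2p3 n G H connected ¬complete sq girth =
  ( (λ v → VF⇒non-end , non-end⇒VF)
  , (λ u v → (λ f → forced⇒adj f , forced⇒non-end f , forced⇒non-end (forced-sym f))
           , (λ (uv , ¬end-u , ¬end-v) → non-end-edge⇒forced uv ¬end-u ¬end-v)) )
  , (λ Q → maximal-clique∩VF-star)
  , (λ v → outside-VF⇒unique-maximal-clique)
  where open Structure G H sq girth connected ¬complete
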